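{- Let $n\ge0$. Suppose either $(\tilde\gamma,\tilde\sigma)\in\mathcal{CP}'_e(n)$ with $\tilde\sigma$ nonempty, or $(\tilde\gamma,\tilde\sigma)\in\mathcal{CP}'_o(n)$ with $\tilde\sigma$ nonempty and $s(\tilde\sigma)<2\ell(\tilde\gamma)$. Then $f\circ g((\tilde\gamma,\tilde\sigma))=(\tilde\gamma,\tilde\sigma)$.
   Context: Partitions are finite multisets of positive integers; parts of size $0$ are discarded. For a partition $\pi$: $\ell(\pi)$ is its largest part ($0$ if $\pi$ is empty); $\ell_e(\pi)$ is its largest even part ($0$ if $\pi$ has no even parts); $s(\pi)$ is its smallest part. $\mathcal{CP}'(n)$ is the set of pairs of partitions $(\tilde\gamma,\tilde\sigma)$ with $|\tilde\gamma|+|\tilde\sigma|=n$ such that all parts of $\tilde\sigma$ are odd, every part of $\tilde\sigma$ is at least $\ell(\tilde\gamma)+\ell_e(\tilde\gamma)$, and $\tilde\gamma$ satisfies one of the following: ($o$) the largest part $\ell(\tilde\gamma)$ is odd and is the only part size of $\tilde\gamma$ with odd multiplicity; ($e$) either $\tilde\gamma$ has an even part and $\ell_e(\tilde\gamma)$ is the only part size with odd multiplicity, or $\tilde\gamma$ has no even parts and every part size has even multiplicity (including $\tilde\gamma$ empty). $\mathcal{CP}'_o(n)$ consists of the pairs satisfying ($o$), $\mathcal{CP}'_e(n)$ of those satisfying ($e$). Define $o(\tilde\gamma)=\ell(\tilde\gamma)$ in case ($o$) and $o(\tilde\gamma)=\ell_e(\tilde\gamma)$ in case ($e$). For $(\tilde\gamma,\tilde\sigma)\in\mathcal{CP}'(n)$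 with $\ell(\tilde\gamma)\neq\ell_e(\tilde\gamma)$, $f((\tilde\gamma,\tilde\sigma))$ is obtained by removing one copy of $\ell(\tilde\gamma)$ and one copy of $\ell_e(\tilde\gamma)$ from $\tilde\gamma$ (nothing is removed for a value $0$) and adding a part $\ell(\tilde\gamma)+\ell_e(\tilde\gamma)$ to $\tilde\sigma$. For $(\tilde\gamma,\tilde\sigma)\in\mathcal{CP}'(n)$ with $\tilde\sigma$ nonempty, $g((\tilde\gamma,\tilde\sigma))$ is obtained by removing one copy of $s(\tilde\sigma)$ from $\tilde\sigma$ and adding to $\tilde\gamma$ the two parts $o(\tilde\gamma)$ and $s(\tilde\sigma)-o(\tilde\gamma)$ (parts equal to $0$ are not added). -}

module Defs where

open import Data.Nat using (ℕ; zero; suc; _+_; _∸_; _≤_; _<_; _⊔_; _⊓_; _*_; _≡ᵇ_)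
open import Data.Nat.Properties using (_≟_)
open import Data.Nat.Divisibility using (_∣_; _∣?_)
open import Data.List using (List; []; _∷_; foldr; filter; length)
open import Data.Nat.ListAction using (sum)
open import Data.List.Relation.Unary.All using (All)
open import Data.List.Relation.Unary.Any using (Any)
open import Data.Bool using (Bool; true; false; if_then_else_)
open import Data.Product using (_×_; _,_)
open import Data.Sum using (_⊎_)
open import Relation.Nullary using (¬_; does)
open import Relation.Binary.PropositionalEquality using (_≡_)

-- A partition is represented by a list of its parts (order irrelevant;
-- multiset equality is permutation _↭_). Parts are required positive.
Partition : Set
Partition = List ℕ

Even : ℕ → Set
Even n = 2 ∣ n

Odd : ℕ → Set
Odd n = ¬ (2 ∣ n)

Positive : Partition → Set
Positive π = All (λ x → 0 < x) π

size : Partition → ℕ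
size = sum

ℓ : Partition → ℕ
ℓ = foldr _⊔_ 0

ℓe : Partition → ℕ
ℓe = foldr (λ x m → if does (2 ∣? x) then x ⊔ m else m) 0

-- s(π): smallest part (only meaningful for nonempty π; 0 for empty)
s : Partition → ℕ
s []       = 0
s (x ∷ xs) = foldr _⊓_ x xs

mult : ℕ → Partition → ℕ
mult k π = length (filter (_≟ k) π)

CondO : Partition → Set
CondO γ = Odd (ℓ γ) × Odd (mult (ℓ γ) γ)
        × (∀ k → 0 < k → Odd (mult k γ) → k ≡ ℓ γ)

CondE : Partition → Set
CondE γ = (Any Even γ × Odd (mult (ℓe γ) γ)
            × (∀ k → 0 < k → Odd (mult k γ) → k ≡ ℓe γ))
        ⊎ (¬ Any Even γ × (∀ k → 0 < k → Even (mult k γ)))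

CPBase : ℕ → Partition → Partition → Set
CPBase n γ σ = size γ + size σ ≡ n × Positive γ × Positive σ
             × All Odd σ × All (λ p → ℓ γ + ℓe γ ≤ p) σ

CP'o : ℕ → Partition → Partition → Set
CP'o n γ σ = CPBase n γ σ × CondO γ

CP'e : ℕ → Partition → Partition → Set
CP'e n γ σ = CPBase n γ σ × CondE γ

-- which case the pair is in (the cases are disjoint); determines o(γ)
data Case : Set where
  caseO caseE : Case

o : Case → Partition → ℕ
o caseO γ = ℓ γ
o caseE γ = ℓe γ

removeOne : ℕ → Partition → Partition
removeOne zero    π        = π
removeOne (suc k) []       = []
removeOne (suc k) (x ∷ xs) = if x ≡ᵇ suc k then xs else x ∷ removeOne (suc k) xs

addPart : ℕ → Partition → Partition
addPart zero    π = π
addPart (suc k) π = suc k ∷ π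

f : Partition × Partition → Partition × Partition
f (γ , σ) = removeOne (ℓe γ) (removeOne (ℓ γ) γ) , addPart (ℓ γ + ℓe γ) σ

g : Case → Partition × Partition → Partition × Partition
g c (γ , σ) = addPart (s σ ∸ o c γ) (addPart (o c γ) γ) , removeOne (s σ) σ

open import Data.List.Relation.Binary.Permutation.Propositional using (_↭_)

_≈P_ : Partition × Partition → Partition × Partition → Set
(γ , σ) ≈P (γ' , σ') = γ ↭ γ' × σ ↭ σ'

{-# OPTIONS --safe #-}
-- g adds to γ the parts a = o(γ) and b = s(σ) ∸ a. The hypotheses force these two new
-- parts to be exactly ℓ and ℓe of the enlarged partition: in case (e), b is odd and at
-- least ℓ(γ) while a = ℓe(γ); in case (o), a = ℓ(γ) is odd and b is even with
-- ℓe(γ) ≤ b < a. Hence f removes precisely them again and returns their sum s(σ) to σ.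
module Submission where

open import Defs
open import Data.Nat using (ℕ; zero; suc; _<_; _*_; _+_; _∸_; _≤_; _⊔_; _≡ᵇ_; z≤n; s≤s)
open import Data.Nat.Properties
  using (≡ᵇ⇒≡; ≡⇒≡ᵇ; ≤-reflexive; ≤-trans; ⊓-sel; ⊔-sel; ⊔-idem; ⊔-monoʳ-≤; m≤n⊔m;
         m≤n⇒m⊔n≡n; m≥n⇒m⊔n≡m; m+n≤o⇒m≤o; m+n≤o⇒n≤o; m+n≤o⇒m≤o∸n; m∸n+n≡m; m+[n∸m]≡n; +-comm;
         +-identityʳ; +-cancelˡ-<; <⇒≤; <⇒≢)
open import Data.Nat.Divisibility using (_∣?_; _∣0; ∣-refl; ∣m∣n⇒∣m+n; ∣m+n∣m⇒∣n; ∣m∸n∣n⇒∣m)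
open import Data.List using ([]; _∷_)
open import Data.List.Relation.Unary.All using () renaming (lookup to All-lookup)
open import Data.List.Relation.Unary.Any using (here; there)
open import Data.List.Membership.Propositional using (_∈_)
open import Data.List.Membership.Propositional.Properties using (foldr-selective)
open import Data.List.Relation.Binary.Permutation.Propositional using (_↭_; prep; swap; ↭-refl; ↭-trans)
open import Data.Bool using (true; false; T; if_then_else_)
open import Data.Bool.Properties using (T-≡)
open import Data.Product using (_×_; _,_)
open import Data.Sum using (inj₁; inj₂)
open import Data.Empty using (⊥-elim)
open import Function.Bundles using (Equivalence)
open import Relation.Nullary using (yes; no; contradiction)
open import Relation.Nullary.Decidable using (dec-true; dec-false)
open import Relation.Binary.PropositionalEquality using (_≡_; _≢_; refl; sym; cong; subst; module ≡-Reasoning)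

odd⇒even-suc : ∀ n → Odd n → Even (suc n)
odd⇒even-suc zero    odd = ⊥-elim (odd (2 ∣0))
odd⇒even-suc (suc n) odd with 2 ∣? n
... | yes even = ∣m∣n⇒∣m+n (∣-refl {2}) even
... | no  odd′ = ⊥-elim (odd (odd⇒even-suc n odd′))

even∸even : ∀ {m n} → n ≤ m → Even m → Even n → Even (m ∸ n)
even∸even n≤m 2∣m 2∣n = ∣m+n∣m⇒∣n (subst Even (sym (m+[n∸m]≡n n≤m)) 2∣m) 2∣n

odd∸odd : ∀ {m n} → n ≤ m → Odd m → Odd n → Even (m ∸ n)
odd∸odd {m} {n} n≤m odd-m odd-n =
  even∸even (s≤s n≤m) (odd⇒even-suc m odd-m) (odd⇒even-suc n odd-n)

odd∸even : ∀ {m n} → n ≤ m → Odd m → Even n → Odd (m ∸ n)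
odd∸even n≤m odd-m even-n even-m∸n = odd-m (∣m∸n∣n⇒∣m 2 n≤m even-m∸n even-n)

m<2n⇒m∸n<n : ∀ {m n} → n ≤ m → m < 2 * n → m ∸ n < n
m<2n⇒m∸n<n {m} {n} n≤m m<2n =
  +-cancelˡ-< n (m ∸ n) n (subst (_< n + n) (sym (m+[n∸m]≡n n≤m))
                                 (subst (m <_) (cong (n +_) (+-identityʳ n)) m<2n))

s-∈ : ∀ {σ} → σ ≢ [] → s σ ∈ σ
s-∈ {[]}    σ≢[] = contradiction refl σ≢[]
s-∈ {x ∷ xs} _ with foldr-selective ⊓-sel x xs
... | inj₁ s≡x  = here s≡x
... | inj₂ s∈xs = there s∈xs

ℓ-addPart : ∀ a xs → ℓ (addPart a xs) ≡ a ⊔ ℓ xs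
ℓ-addPart zero    xs = refl
ℓ-addPart (suc a) xs = refl

ℓe-∷-even : ∀ {x} xs → Even x → ℓe (x ∷ xs) ≡ x ⊔ ℓe xs
ℓe-∷-even {x} xs even = cong (if_then x ⊔ ℓe xs else ℓe xs) (dec-true (2 ∣? x) even)

ℓe-∷-odd : ∀ {x} xs → Odd x → ℓe (x ∷ xs) ≡ ℓe xs
ℓe-∷-odd {x} xs odd = cong (if_then x ⊔ ℓe xs else ℓe xs) (dec-false (2 ∣? x) odd)

ℓe-addPart-even : ∀ {a} xs → Even a → ℓe (addPart a xs) ≡ a ⊔ ℓe xs
ℓe-addPart-even {zero}  xs _    = refl
ℓe-addPart-even {suc a} xs even = ℓe-∷-even xs even

ℓe-addPart-odd : ∀ {a} xs → Odd a → ℓe (addPart a xs) ≡ ℓe xs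
ℓe-addPart-odd {zero}  xs _   = refl
ℓe-addPart-odd {suc a} xs odd = ℓe-∷-odd xs odd

ℓe-even : ∀ xs → Even (ℓe xs)
ℓe-even []       = 2 ∣0
ℓe-even (x ∷ xs) with 2 ∣? x
... | no  odd  = subst Even (sym (ℓe-∷-odd xs odd)) (ℓe-even xs)
... | yes even = subst Even (sym (ℓe-∷-even xs even)) (⊔-closed even (ℓe-even xs))
  where
  ⊔-closed : ∀ {m n} → Even m → Even n → Even (m ⊔ n)
  ⊔-closed {m} {n} even-m even-n with ⊔-sel m n
  ... | inj₁ m⊔n≡m = subst Even (sym m⊔n≡m) even-m
  ... | inj₂ m⊔n≡n = subst Even (sym m⊔n≡n) even-n

ℓe≤ℓ : ∀ xs → ℓe xs ≤ ℓ xs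
ℓe≤ℓ []       = z≤n
ℓe≤ℓ (x ∷ xs) with 2 ∣? x
... | yes even = ≤-trans (≤-reflexive (ℓe-∷-even xs even)) (⊔-monoʳ-≤ x (ℓe≤ℓ xs))
... | no  odd  = ≤-trans (≤-reflexive (ℓe-∷-odd xs odd)) (≤-trans (ℓe≤ℓ xs) (m≤n⊔m x (ℓ xs)))

removeOne-addPart : ∀ a xs → removeOne a (addPart a xs) ≡ xs
removeOne-addPart zero    xs = refl
removeOne-addPart (suc a) xs = cong (if_then xs else suc a ∷ removeOne (suc a) xs)
                                    (Equivalence.to T-≡ (≡⇒≡ᵇ a a refl))

removeOne-addPart-≢ : ∀ {a b} xs → a ≢ b →
                      removeOne b (addPart a xs) ≡ addPart a (removeOne b xs)
removeOne-addPart-≢ {zero}          xs _   = refl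
removeOne-addPart-≢ {suc a} {zero}  xs _   = refl
removeOne-addPart-≢ {suc a} {suc b} xs a≢b with a ≡ᵇ b in eq
... | true  = contradiction (cong suc (≡ᵇ⇒≡ a b (subst T (sym eq) _))) a≢b
... | false = refl

addPart-removeOne-↭ : ∀ {a xs} → a ∈ xs → addPart a (removeOne a xs) ↭ xs
addPart-removeOne-↭ {zero}          _   = ↭-refl
addPart-removeOne-↭ {suc a} {x ∷ xs} a∈ with x ≡ᵇ suc a in eq | a∈
... | true  | _          rewrite ≡ᵇ⇒≡ x (suc a) (subst T (sym eq) _) = ↭-refl
... | false | here refl  = ⊥-elim (subst T eq (≡⇒≡ᵇ x x refl))
... | false | there a∈xs = ↭-trans (swap (suc a) x ↭-refl) (prep x (addPart-removeOne-↭ a∈xs))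

f-addPart₂ : ∀ a b γ σ → let γ′ = addPart b (addPart a γ) in
             ℓ γ′ ≡ b → ℓe γ′ ≡ a → f (γ′ , σ) ≡ (γ , addPart (b + a) σ)
f-addPart₂ a b γ σ ℓ≡b ℓe≡a
  rewrite ℓ≡b | ℓe≡a | removeOne-addPart b (addPart a γ) | removeOne-addPart a γ = refl

f-addPart₂-swapped : ∀ a b γ σ → let γ′ = addPart b (addPart a γ) in
                     b ≢ a → ℓ γ′ ≡ a → ℓe γ′ ≡ b → f (γ′ , σ) ≡ (γ , addPart (a + b) σ)
f-addPart₂-swapped a b γ σ b≢a ℓ≡a ℓe≡b
  rewrite ℓ≡a | ℓe≡b | removeOne-addPart-≢ (addPart a γ) b≢a
        | removeOne-addPart a γ | removeOne-addPart b γ = refl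

restore-σ : ∀ {γ σ m k} → m ∈ σ → k ≡ m → (γ , addPart k (removeOne m σ)) ≈P (γ , σ)
restore-σ m∈σ refl = ↭-refl , addPart-removeOne-↭ m∈σ

module _ (γ σ : Partition) (m∈σ : s σ ∈ σ) (odd-m : Odd (s σ)) (bound : ℓ γ + ℓe γ ≤ s σ) where

  open ≡-Reasoning

  private
    m = s σ
    L = ℓ γ
    e = ℓe γ

  f∘g-caseE : f (g caseE (γ , σ)) ≈P (γ , σ)
  f∘g-caseE = subst (_≈P (γ , σ)) (sym (f-addPart₂ e (m ∸ e) γ (removeOne m σ) ℓ-γ′ ℓe-γ′))
                    (restore-σ m∈σ (m∸n+n≡m e≤m))
    where
    e≤m : e ≤ m
    e≤m = m+n≤o⇒n≤o L bound

    odd-m∸e : Odd (m ∸ e)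
    odd-m∸e = odd∸even e≤m odd-m (ℓe-even γ)

    ℓ-γ′ : ℓ (addPart (m ∸ e) (addPart e γ)) ≡ m ∸ e
    ℓ-γ′ = begin
      ℓ (addPart (m ∸ e) (addPart e γ)) ≡⟨ ℓ-addPart (m ∸ e) (addPart e γ) ⟩
      (m ∸ e) ⊔ ℓ (addPart e γ)         ≡⟨ cong ((m ∸ e) ⊔_) (ℓ-addPart e γ) ⟩
      (m ∸ e) ⊔ (e ⊔ L)                 ≡⟨ cong ((m ∸ e) ⊔_) (m≤n⇒m⊔n≡n (ℓe≤ℓ γ)) ⟩
      (m ∸ e) ⊔ L                       ≡⟨ m≥n⇒m⊔n≡m (m+n≤o⇒m≤o∸n L bound) ⟩
      m ∸ e                             ∎

    ℓe-γ′ : ℓe (addPart (m ∸ e) (addPart e γ)) ≡ e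
    ℓe-γ′ = begin
      ℓe (addPart (m ∸ e) (addPart e γ)) ≡⟨ ℓe-addPart-odd (addPart e γ) odd-m∸e ⟩
      ℓe (addPart e γ)                   ≡⟨ ℓe-addPart-even γ (ℓe-even γ) ⟩
      e ⊔ e                              ≡⟨ ⊔-idem e ⟩
      e                                  ∎

  f∘g-caseO : Odd L → m < 2 * L → f (g caseO (γ , σ)) ≈P (γ , σ)
  f∘g-caseO odd-L m<2L =
    subst (_≈P (γ , σ)) (sym (f-addPart₂-swapped L d γ (removeOne m σ) (<⇒≢ d<L) ℓ-γ′ ℓe-γ′))
          (restore-σ m∈σ (m+[n∸m]≡n L≤m))
    where
    d = m ∸ L

    L≤m : L ≤ m
    L≤m = m+n≤o⇒m≤o L bound

    d<L : d < L
    d<L = m<2n⇒m∸n<n L≤m m<2L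

    e≤d : e ≤ d
    e≤d = m+n≤o⇒m≤o∸n e (subst (_≤ m) (+-comm L e) bound)

    ℓ-γ′ : ℓ (addPart d (addPart L γ)) ≡ L
    ℓ-γ′ = begin
      ℓ (addPart d (addPart L γ)) ≡⟨ ℓ-addPart d (addPart L γ) ⟩
      d ⊔ ℓ (addPart L γ)         ≡⟨ cong (d ⊔_) (ℓ-addPart L γ) ⟩
      d ⊔ (L ⊔ L)                 ≡⟨ cong (d ⊔_) (⊔-idem L) ⟩
      d ⊔ L                       ≡⟨ m≤n⇒m⊔n≡n (<⇒≤ d<L) ⟩
      L                           ∎

    ℓe-γ′ : ℓe (addPart d (addPart L γ)) ≡ d
    ℓe-γ′ = begin
      ℓe (addPart d (addPart L γ)) ≡⟨ ℓe-addPart-even (addPart L γ) (odd∸odd L≤m odd-m odd-L) ⟩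
      d ⊔ ℓe (addPart L γ)         ≡⟨ cong (d ⊔_) (ℓe-addPart-odd γ odd-L) ⟩
      d ⊔ e                        ≡⟨ m≥n⇒m⊔n≡m e≤d ⟩
      d                            ∎

lemma3 : (n : ℕ) (γ σ : Partition) → σ ≢ [] →
    (CP'e n γ σ → f (g caseE (γ , σ)) ≈P (γ , σ))
    × (CP'o n γ σ → s σ < 2 * ℓ γ → f (g caseO (γ , σ)) ≈P (γ , σ))
lemma3 n γ σ σ≢[] = fromCP'e , fromCP'o
  where
  m∈σ : s σ ∈ σ
  m∈σ = s-∈ σ≢[]

  fromCP'e : CP'e n γ σ → f (g caseE (γ , σ)) ≈P (γ , σ)
  fromCP'e ((_ , _ , _ , all-odd , all-bound) , _) =
    f∘g-caseE γ σ m∈σ (All-lookup all-odd m∈σ) (All-lookup all-bound m∈σ)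

  fromCP'o : CP'o n γ σ → s σ < 2 * ℓ γ → f (g caseO (γ , σ)) ≈P (γ , σ)
  fromCP'o ((_ , _ , _ , all-odd , all-bound) , odd-ℓ , _) =
    f∘g-caseO γ σ m∈σ (All-lookup all-odd m∈σ) (All-lookup all-bound m∈σ) odd-ℓ
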